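{- Let $n$ be a positive integer and $x$ a real number. Let $x_n = \max\{ [kx]/k : k = 1, 2, \dots, n\}$ and let $d_{n,x}$ be the smallest element $d$ of $\{1, \dots, n\}$ such that $[dx]/d = x_n$. If $d_{n,x} = 1$, then $[nx] = \sum_{k=1}^{n} \frac{[kx]}{k}$; otherwise $[nx] \ge \frac{1}{6} + \sum_{k=1}^{n} \frac{[kx]}{k}$.
   Context: $[t]$ denotes the greatest integer less than or equal to $t$. -}

module Defs where

open import Data.Nat as ℕ using (ℕ; zero; suc)
open import Data.Integer as ℤ using (ℤ; +_)
open import Data.Rational using (ℚ; _/_; _<_; _+_; _⊔_; 0ℚ)
open import Data.Product using (∃; _×_)
open import Data.Sum using (_⊎_)
open import Data.Unit using (⊤)
open import Relation.Nullary using (¬_)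
open import Relation.Binary.PropositionalEquality using (_≡_; _≢_)

-- Real numbers as (two-sided) Dedekind cuts over ℚ:
-- L q means q < x, U q means x < q.
record ℝ : Set₁ where
  field
    L U         : ℚ → Set
    inhabitedL  : ∃ L
    inhabitedU  : ∃ U
    roundedL    : ∀ q → L q → ∃ λ r → q < r × L r
    roundedL'   : ∀ q r → q < r → L r → L q
    roundedU    : ∀ q → U q → ∃ λ r → r < q × U r
    roundedU'   : ∀ q r → q < r → U q → U r
    disjoint    : ∀ q → ¬ (L q × U q)
    located     : ∀ q r → q < r → L q ⊎ U r
open ℝ public

-- IsFloorMul x k m  :  m = [k x]  (for k ≥ 1), i.e. m ≤ k x < m + 1,
-- i.e. m / k ≤ x < (m + 1) / k, where q ≤ x means ¬ (x < q).
-- The k = 0 case is never used.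
IsFloorMul : ℝ → ℕ → ℤ → Set
IsFloorMul x zero    m = ⊤
IsFloorMul x (suc j) m = ¬ U x (m / suc j) × U x ((m ℤ.+ + 1) / suc j)

-- frac a k = a k / k  (the value at k = 0 is junk and never used)
frac : (ℕ → ℤ) → ℕ → ℚ
frac a zero    = 0ℚ
frac a (suc j) = a (suc j) / suc j

xmax : (ℕ → ℤ) → ℕ → ℚ
xmax a zero    = frac a 1
xmax a (suc n) = xmax a n ⊔ frac a (suc n)

sumFrac : (ℕ → ℤ) → ℕ → ℚ
sumFrac a zero    = 0ℚ
sumFrac a (suc n) = sumFrac a n + frac a (suc n)

IsSmallestArgmax : (ℕ → ℤ) → ℕ → ℕ → Set
IsSmallestArgmax a n d =
  1 ℕ.≤ d × d ℕ.≤ n × frac a d ≡ xmax a n ×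
  (∀ d′ → 1 ℕ.≤ d′ → d′ ℕ.< d → frac a d′ ≢ xmax a n)

-- Let d be the smallest maximiser and p = a d. Then a k = ⌊k p / d⌋ for k ≤ n, so
-- r k = k p − d (a k) is the residue of k p modulo d: it lies in [0, d), is subadditive
-- and d-periodic, vanishes at d, and by minimality of d satisfies r k + r (d − k) = d
-- for 0 < k < d. Summing a k / k = (p − r k / k) / d gives
--   d (a n − Σ_{k ≤ n} a k / k) = Σ_{k ≤ n} r k / k − r n.
-- For d = 1 every residue vanishes. Otherwise write n ≡ s + d (mod d) with s < d. The
-- terms beyond s + d are nonnegative, the classical bound r s ≤ Σ_{k ≤ s} r k / k for
-- subadditive sequences absorbs r n = r s, and the remaining window s < k ≤ s + d has
-- weights 1/k ≥ 1/(2d − 1), so the right-hand side is at least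
-- (Σ_{k < d} r k) / (2d − 1) = (d − 1) d / (2 (2d − 1)) ≥ d / 6.

module Submission where

open import Defs
open import Data.Empty using (⊥-elim)
open import Data.Sum using (inj₁; inj₂)
open import Data.Product using (_×_; _,_; proj₁; proj₂; Σ-syntax)
open import Data.Nat as ℕ using (ℕ; zero; suc; _∸_; z≤n; s≤s)
import Data.Nat.Properties as ℕP
open import Data.Integer as ℤ using (ℤ; +_)
import Data.Integer.Properties as ℤP
open import Data.Nat.Tactic.RingSolver using () renaming (solve-∀ to ℕ-solve-∀)
import Data.Nat.DivMod as ℕ
open import Data.Integer.Tactic.RingSolver using () renaming (solve-∀ to ℤ-solve-∀)
open import Data.Rational as ℚ using (ℚ; _/_; _+_; _*_; _-_; _≤_; _<_; 0ℚ; 1ℚ; toℚᵘ)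
import Data.Rational.Properties as ℚP
open import Data.Rational.Solver using (module +-*-Solver)
open +-*-Solver using (solve; _:=_; _:+_; _:*_; _:-_; con)
open import Data.Rational.Unnormalised using (mkℚᵘ; *≡*; *≤*) renaming (_≃_ to _≃ᵘ_)
import Data.Rational.Unnormalised.Properties as ℚᵘP
open import Relation.Nullary using (¬_)
open import Relation.Binary.Definitions using (tri<; tri≈; tri>)
open import Relation.Binary.PropositionalEquality
open import Algebra.Properties.Group ℚP.+-0-group using () renaming (∙-cancelˡ to +-cancelˡ)

fromℤ : ℤ → ℚ
fromℤ z = z / 1

-- The value at 0 is junk, as for frac.
recip : ℕ → ℚ
recip zero    = 0ℚ
recip (suc j) = + 1 / suc j

toℚᵘ-/ : ∀ z j → toℚᵘ (z / suc j) ≃ᵘ mkℚᵘ z j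
toℚᵘ-/ z j = ℚP.toℚᵘ-fromℚᵘ (mkℚᵘ z j)

≃ᵘ⇒≡/ : ∀ {q} z j → toℚᵘ q ≃ᵘ mkℚᵘ z j → q ≡ z / suc j
≃ᵘ⇒≡/ z j q≃ = ℚP.toℚᵘ-injective (ℚᵘP.≃-trans q≃ (ℚᵘP.≃-sym (toℚᵘ-/ z j)))

*≡*⇒/≡/ : ∀ z w i j → z ℤ.* + suc j ≡ w ℤ.* + suc i → z / suc i ≡ w / suc j
*≡*⇒/≡/ z w i j eq = ≃ᵘ⇒≡/ w j (ℚᵘP.≃-trans (toℚᵘ-/ z i) (*≡* eq))

*≤*⇒/≤/ : ∀ z w i j → z ℤ.* + suc j ℤ.≤ w ℤ.* + suc i → z / suc i ≤ w / suc j
*≤*⇒/≤/ z w i j le = ℚP.toℚᵘ-cancel-≤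
  (ℚᵘP.≤-respˡ-≃ (ℚᵘP.≃-sym (toℚᵘ-/ z i)) (ℚᵘP.≤-respʳ-≃ (ℚᵘP.≃-sym (toℚᵘ-/ w j)) (*≤* le)))

/≤/⇒*≤* : ∀ z w i j → z / suc i ≤ w / suc j → z ℤ.* + suc j ℤ.≤ w ℤ.* + suc i
/≤/⇒*≤* z w i j le =
  ℚᵘP.drop-*≤* (ℚᵘP.≤-respˡ-≃ (toℚᵘ-/ z i) (ℚᵘP.≤-respʳ-≃ (toℚᵘ-/ w j) (ℚP.toℚᵘ-mono-≤ le)))

/</⇒*<* : ∀ z w i j → z / suc i < w / suc j → z ℤ.* + suc j ℤ.< w ℤ.* + suc i
/</⇒*<* z w i j lt =
  ℚᵘP.drop-*<* (ℚᵘP.<-respˡ-≃ (toℚᵘ-/ z i) (ℚᵘP.<-respʳ-≃ (toℚᵘ-/ w j) (ℚP.toℚᵘ-mono-< lt)))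

fromℤ-+ : ∀ z w → fromℤ (z ℤ.+ w) ≡ fromℤ z + fromℤ w
fromℤ-+ z w = sym (≃ᵘ⇒≡/ (z ℤ.+ w) 0 (ℚᵘP.≃-trans (ℚP.toℚᵘ-homo-+ (fromℤ z) (fromℤ w))
  (ℚᵘP.≃-trans (ℚᵘP.+-cong (toℚᵘ-/ z 0) (toℚᵘ-/ w 0)) (*≡* (identity z w)))))
  where
  identity : ∀ z w → (z ℤ.* + 1 ℤ.+ w ℤ.* + 1) ℤ.* + 1 ≡ (z ℤ.+ w) ℤ.* + 1
  identity = ℤ-solve-∀

fromℤ-* : ∀ z w → fromℤ (z ℤ.* w) ≡ fromℤ z * fromℤ w
fromℤ-* z w = sym (≃ᵘ⇒≡/ (z ℤ.* w) 0 (ℚᵘP.≃-trans (ℚP.toℚᵘ-homo-* (fromℤ z) (fromℤ w))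
  (ℚᵘP.*-cong (toℚᵘ-/ z 0) (toℚᵘ-/ w 0))))

fromℤ-suc : ∀ m → fromℤ (+ suc m) ≡ fromℤ (+ m) + 1ℚ
fromℤ-suc m = trans (cong (λ k → fromℤ (+ k)) (ℕP.+-comm 1 m)) (fromℤ-+ (+ m) (+ 1))

fromℤ-pos-* : ∀ m n → fromℤ (+ (m ℕ.* n)) ≡ fromℤ (+ m) * fromℤ (+ n)
fromℤ-pos-* m n = trans (cong fromℤ (ℤP.pos-* m n)) (fromℤ-* (+ m) (+ n))

fromℤ-mono-≤ : ∀ {z w} → z ℤ.≤ w → fromℤ z ≤ fromℤ w
fromℤ-mono-≤ {z} {w} z≤w = *≤*⇒/≤/ z w 0 0 (subst₂ ℤ._≤_ (sym (ℤP.*-identityʳ z)) (sym (ℤP.*-identityʳ w)) z≤w)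

/≡fromℤ*recip : ∀ z j → z / suc j ≡ fromℤ z * recip (suc j)
/≡fromℤ*recip z j = sym (≃ᵘ⇒≡/ z j (ℚᵘP.≃-trans (ℚP.toℚᵘ-homo-* (fromℤ z) (recip (suc j)))
  (ℚᵘP.≃-trans (ℚᵘP.*-cong (toℚᵘ-/ z 0) (toℚᵘ-/ (+ 1) j)) (*≡* (ℤP.*-assoc z (+ 1) (+ suc j))))))

frac≡*recip : ∀ b k → frac b k ≡ fromℤ (b k) * recip k
frac≡*recip b zero    = sym (ℚP.*-zeroʳ (fromℤ (b zero)))
frac≡*recip b (suc j) = /≡fromℤ*recip (b (suc j)) j

recip-inverse : ∀ j → fromℤ (+ suc j) * recip (suc j) ≡ 1ℚ
recip-inverse j = trans (sym (/≡fromℤ*recip (+ suc j) j)) (*≡*⇒/≡/ (+ suc j) (+ 1) j 0 (ℤP.*-comm (+ suc j) (+ 1)))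

recip-nonNeg : ∀ k → 0ℚ ≤ recip k
recip-nonNeg zero    = ℚP.≤-refl
recip-nonNeg (suc j) = *≤*⇒/≤/ (+ 0) (+ 1) 0 j (ℤ.+≤+ z≤n)

recip-antitone : ∀ {k m} → 1 ℕ.≤ k → k ℕ.≤ m → recip m ≤ recip k
recip-antitone {suc i} {suc j} _ k≤m =
  *≤*⇒/≤/ (+ 1) (+ 1) j i (subst₂ ℤ._≤_ (sym (ℤP.*-identityˡ _)) (sym (ℤP.*-identityˡ _)) (ℤ.+≤+ k≤m))

sumTo : (ℕ → ℚ) → ℕ → ℚ
sumTo f zero    = 0ℚ
sumTo f (suc m) = sumTo f m + f (suc m)

module _ {f g : ℕ → ℚ} where

  sumTo-cong : ∀ m → (∀ k → 1 ℕ.≤ k → k ℕ.≤ m → f k ≡ g k) → sumTo f m ≡ sumTo g m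
  sumTo-cong zero    f≡g = refl
  sumTo-cong (suc m) f≡g =
    cong₂ _+_ (sumTo-cong m (λ k 1≤k k≤m → f≡g k 1≤k (ℕP.m≤n⇒m≤1+n k≤m))) (f≡g (suc m) (s≤s z≤n) ℕP.≤-refl)

  sumTo-mono-≤ : ∀ m → (∀ k → 1 ℕ.≤ k → k ℕ.≤ m → f k ≤ g k) → sumTo f m ≤ sumTo g m
  sumTo-mono-≤ zero    f≤g = ℚP.≤-refl
  sumTo-mono-≤ (suc m) f≤g =
    ℚP.+-mono-≤ (sumTo-mono-≤ m (λ k 1≤k k≤m → f≤g k 1≤k (ℕP.m≤n⇒m≤1+n k≤m))) (f≤g (suc m) (s≤s z≤n) ℕP.≤-refl)

  sumTo-+ : ∀ m → sumTo (λ k → f k + g k) m ≡ sumTo f m + sumTo g m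
  sumTo-+ zero    = refl
  sumTo-+ (suc m) = begin
    sumTo (λ k → f k + g k) m + (f (suc m) + g (suc m)) ≡⟨ cong (_+ (f (suc m) + g (suc m))) (sumTo-+ m) ⟩
    sumTo f m + sumTo g m + (f (suc m) + g (suc m))     ≡⟨ +-interchange (sumTo f m) (sumTo g m) (f (suc m)) (g (suc m)) ⟩
    sumTo f m + f (suc m) + (sumTo g m + g (suc m))     ∎
    where
    open ≡-Reasoning
    +-interchange : ∀ a b c d → a + b + (c + d) ≡ a + c + (b + d)
    +-interchange = solve 4 (λ a b c d → a :+ b :+ (c :+ d) := a :+ c :+ (b :+ d)) refl

module _ {f : ℕ → ℚ} where

  sumTo-nonNeg : ∀ m → (∀ k → 1 ℕ.≤ k → k ℕ.≤ m → 0ℚ ≤ f k) → 0ℚ ≤ sumTo f m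
  sumTo-nonNeg zero    f≥0 = ℚP.≤-refl
  sumTo-nonNeg (suc m) f≥0 =
    ℚP.+-mono-≤ (sumTo-nonNeg m (λ k 1≤k k≤m → f≥0 k 1≤k (ℕP.m≤n⇒m≤1+n k≤m))) (f≥0 (suc m) (s≤s z≤n) ℕP.≤-refl)

  sumTo-*ˡ : ∀ c m → sumTo (λ k → c * f k) m ≡ c * sumTo f m
  sumTo-*ˡ c zero    = sym (ℚP.*-zeroʳ c)
  sumTo-*ˡ c (suc m) = trans (cong (_+ c * f (suc m)) (sumTo-*ˡ c m)) (sym (ℚP.*-distribˡ-+ c (sumTo f m) (f (suc m))))

  sumTo-split : ∀ s m → sumTo f (s ℕ.+ m) ≡ sumTo f s + sumTo (λ j → f (s ℕ.+ j)) m
  sumTo-split s zero    rewrite ℕP.+-identityʳ s = sym (ℚP.+-identityʳ (sumTo f s))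
  sumTo-split s (suc m) rewrite ℕP.+-suc s m =
    trans (cong (_+ f (suc (s ℕ.+ m))) (sumTo-split s m))
          (ℚP.+-assoc (sumTo f s) (sumTo (λ j → f (s ℕ.+ j)) m) (f (suc (s ℕ.+ m))))

  sumTo-unfoldˡ : ∀ m → sumTo f (suc m) ≡ f 1 + sumTo (λ j → f (suc j)) m
  sumTo-unfoldˡ m = trans (sumTo-split 1 m) (cong (_+ sumTo (λ j → f (suc j)) m) (ℚP.+-identityˡ (f 1)))

sumTo-const : ∀ c m → sumTo (λ _ → c) m ≡ fromℤ (+ m) * c
sumTo-const c zero    = sym (ℚP.*-zeroˡ c)
sumTo-const c (suc m) = begin
  sumTo (λ _ → c) m + c   ≡⟨ cong (_+ c) (sumTo-const c m) ⟩
  fromℤ (+ m) * c + c     ≡⟨ distrib (fromℤ (+ m)) c ⟩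
  (fromℤ (+ m) + 1ℚ) * c  ≡⟨ cong (_* c) (fromℤ-suc m) ⟨
  fromℤ (+ suc m) * c     ∎
  where
  open ≡-Reasoning
  distrib : ∀ x c → x * c + c ≡ (x + 1ℚ) * c
  distrib = solve 2 (λ x c → x :* c :+ c := (x :+ con 1ℚ) :* c) refl

sumTo-extend : ∀ {f : ℕ → ℚ} {m m′} → m ℕ.≤ m′ → (∀ k → m ℕ.< k → k ℕ.≤ m′ → 0ℚ ≤ f k) → sumTo f m ≤ sumTo f m′
sumTo-extend {f} {m} m≤m′ f≥0 with ℕP.m≤n⇒∃[o]m+o≡n m≤m′
... | o , refl = begin
  sumTo f m                                     ≡⟨ ℚP.+-identityʳ (sumTo f m) ⟨
  sumTo f m + 0ℚ                                ≤⟨ ℚP.+-monoʳ-≤ (sumTo f m) (sumTo-nonNeg o tail≥0) ⟩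
  sumTo f m + sumTo (λ j → f (m ℕ.+ j)) o       ≡⟨ sumTo-split m o ⟨
  sumTo f (m ℕ.+ o)                             ∎
  where
  open ℚP.≤-Reasoning
  tail≥0 : ∀ j → 1 ℕ.≤ j → j ℕ.≤ o → 0ℚ ≤ f (m ℕ.+ j)
  tail≥0 j 1≤j j≤o = f≥0 (m ℕ.+ j) (ℕP.m<m+n m 1≤j) (ℕP.+-monoʳ-≤ m j≤o)

sumTo-reverse : ∀ f m → sumTo f m ≡ sumTo (λ j → f (suc m ∸ j)) m
sumTo-reverse f zero    = refl
sumTo-reverse f (suc m) = begin
  sumTo f m + f (suc m)                                 ≡⟨ cong (_+ f (suc m)) (sumTo-reverse f m) ⟩
  sumTo (λ j → f (suc m ∸ j)) m + f (suc m)             ≡⟨ ℚP.+-comm (sumTo (λ j → f (suc m ∸ j)) m) (f (suc m)) ⟩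
  f (suc m) + sumTo (λ j → f (suc m ∸ j)) m             ≡⟨ sumTo-unfoldˡ {λ j → f (suc (suc m) ∸ j)} m ⟨
  sumTo (λ j → f (suc (suc m) ∸ j)) (suc m)             ∎
  where open ≡-Reasoning

sumTo-+-reverse : ∀ f m → sumTo (λ k → f k + f (suc m ∸ k)) m ≡ sumTo f m + sumTo f m
sumTo-+-reverse f m = begin
  sumTo (λ k → f k + f (suc m ∸ k)) m           ≡⟨ sumTo-+ m ⟩
  sumTo f m + sumTo (λ k → f (suc m ∸ k)) m     ≡⟨ cong (λ t → sumTo f m + t) (sumTo-reverse f m) ⟨
  sumTo f m + sumTo f m                         ∎
  where open ≡-Reasoning

sumTo-pairs : ∀ f c m → (∀ k → 1 ℕ.≤ k → k ℕ.≤ m → f k + f (suc m ∸ k) ≡ c) →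
              sumTo f m + sumTo f m ≡ fromℤ (+ m) * c
sumTo-pairs f c m pair = begin
  sumTo f m + sumTo f m                ≡⟨ sumTo-+-reverse f m ⟨
  sumTo (λ k → f k + f (suc m ∸ k)) m  ≡⟨ sumTo-cong m pair ⟩
  sumTo (λ _ → c) m                    ≡⟨ sumTo-const c m ⟩
  fromℤ (+ m) * c                      ∎
  where open ≡-Reasoning

ratioSum : (ℕ → ℚ) → ℕ → ℚ
ratioSum f = sumTo (λ k → f k * recip k)

ratioSum-weighted : ∀ f s → fromℤ (+ suc s) * ratioSum f (suc s) ≡ sumTo f (suc s) + sumTo (ratioSum f) s
ratioSum-weighted f zero = base (f 1)
  where
  base : ∀ x → 1ℚ * (0ℚ + x * 1ℚ) ≡ (0ℚ + x) + 0ℚ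
  base = solve 1 (λ x → con 1ℚ :* (con 0ℚ :+ x :* con 1ℚ) := (con 0ℚ :+ x) :+ con 0ℚ) refl
ratioSum-weighted f (suc s) = begin
  fromℤ (+ suc (suc s)) * (R + g * recip (suc (suc s)))   ≡⟨ expand (fromℤ (+ suc (suc s))) R g (recip (suc (suc s))) ⟩
  fromℤ (+ suc (suc s)) * R + g * (fromℤ (+ suc (suc s)) * recip (suc (suc s)))
    ≡⟨ cong₂ (λ c i → c * R + g * i) (fromℤ-suc (suc s)) (recip-inverse (suc s)) ⟩
  (fromℤ (+ suc s) + 1ℚ) * R + g * 1ℚ                    ≡⟨ collect (fromℤ (+ suc s)) R g ⟩
  fromℤ (+ suc s) * R + (R + g)                          ≡⟨ cong (_+ (R + g)) (ratioSum-weighted f s) ⟩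
  sumTo f (suc s) + sumTo (ratioSum f) s + (R + g)       ≡⟨ regroup (sumTo f (suc s)) (sumTo (ratioSum f) s) R g ⟩
  sumTo f (suc s) + g + (sumTo (ratioSum f) s + R)       ∎
  where
  open ≡-Reasoning
  R g : ℚ
  R = ratioSum f (suc s)
  g = f (suc (suc s))
  expand : ∀ c r g i → c * (r + g * i) ≡ c * r + g * (c * i)
  expand = solve 4 (λ c r g i → c :* (r :+ g :* i) := c :* r :+ g :* (c :* i)) refl
  collect : ∀ c r g → (c + 1ℚ) * r + g * 1ℚ ≡ c * r + (r + g)
  collect = solve 3 (λ c r g → (c :+ con 1ℚ) :* r :+ g :* con 1ℚ := c :* r :+ (r :+ g)) refl
  regroup : ∀ a b r g → a + b + (r + g) ≡ a + g + (b + r)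
  regroup = solve 4 (λ a b r g → a :+ b :+ (r :+ g) := a :+ g :+ (b :+ r)) refl

module _ (f : ℕ → ℚ) (N : ℕ)
  (subadditive : ∀ k t → 1 ℕ.≤ k → 1 ℕ.≤ t → k ℕ.+ t ℕ.≤ N → f (k ℕ.+ t) ≤ f k + f t) where

  private
    BoundedUpTo : ℕ → Set
    BoundedUpTo s = ∀ k → 1 ℕ.≤ k → k ℕ.≤ s → f k ≤ ratioSum f k

    subadditive-at : ∀ s → suc s ℕ.≤ N → ∀ j → 1 ℕ.≤ j → j ℕ.≤ s → f (suc s) ≤ f j + f (suc s ∸ j)
    subadditive-at s s<N j 1≤j j≤s = subst (λ m → f m ≤ f j + f (suc s ∸ j)) j+[s+1∸j]≡s+1
      (subadditive j (suc s ∸ j) 1≤j (ℕP.m<n⇒0<n∸m (s≤s j≤s)) (subst (ℕ._≤ N) (sym j+[s+1∸j]≡s+1) s<N))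
      where
      j+[s+1∸j]≡s+1 : j ℕ.+ (suc s ∸ j) ≡ suc s
      j+[s+1∸j]≡s+1 = ℕP.m+[n∸m]≡n (ℕP.m≤n⇒m≤1+n j≤s)

    next : ∀ s → suc s ℕ.≤ N → BoundedUpTo s → f (suc s) ≤ ratioSum f (suc s)
    next s s<N ih = ℚP.*-cancelˡ-≤-pos (fromℤ (+ suc s)) {{ℚP.normalize-pos (suc s) 1}} (begin
      fromℤ (+ suc s) * f (suc s)                      ≡⟨ cong (_* f (suc s)) (fromℤ-suc s) ⟩
      (fromℤ (+ s) + 1ℚ) * f (suc s)                   ≡⟨ distrib (fromℤ (+ s)) (f (suc s)) ⟩
      f (suc s) + fromℤ (+ s) * f (suc s)              ≡⟨ cong (λ t → f (suc s) + t) (sumTo-const (f (suc s)) s) ⟨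
      f (suc s) + sumTo (λ _ → f (suc s)) s            ≤⟨ ℚP.+-monoʳ-≤ (f (suc s)) (sumTo-mono-≤ s (subadditive-at s s<N)) ⟩
      f (suc s) + sumTo (λ j → f j + f (suc s ∸ j)) s  ≡⟨ cong (λ t → f (suc s) + t) (sumTo-+-reverse f s) ⟩
      f (suc s) + (sumTo f s + sumTo f s)              ≡⟨ regroup (f (suc s)) (sumTo f s) ⟩
      sumTo f (suc s) + sumTo f s                      ≤⟨ ℚP.+-monoʳ-≤ (sumTo f (suc s)) (sumTo-mono-≤ s ih) ⟩
      sumTo f (suc s) + sumTo (ratioSum f) s           ≡⟨ ratioSum-weighted f s ⟨
      fromℤ (+ suc s) * ratioSum f (suc s)             ∎)
      where
      open ℚP.≤-Reasoning
      distrib : ∀ c x → (c + 1ℚ) * x ≡ x + c * x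
      distrib = solve 2 (λ c x → (c :+ con 1ℚ) :* x := x :+ c :* x) refl
      regroup : ∀ x S → x + (S + S) ≡ S + x + S
      regroup = solve 2 (λ x S → x :+ (S :+ S) := S :+ x :+ S) refl

    boundedUpTo : ∀ s → s ℕ.≤ N → BoundedUpTo s
    boundedUpTo zero    _ (suc _) _ ()
    boundedUpTo (suc s) s<N k 1≤k k≤s+1 with ℕP.m≤n⇒m<n∨m≡n k≤s+1
    ... | inj₁ k≤s = boundedUpTo s (ℕP.<⇒≤ s<N) k 1≤k (ℕP.≤-pred k≤s)
    ... | inj₂ refl = next s s<N (boundedUpTo s (ℕP.<⇒≤ s<N))

  subadditive⇒≤ratioSum : ∀ s → 1 ℕ.≤ s → s ℕ.≤ N → f s ≤ ratioSum f s
  subadditive⇒≤ratioSum s 1≤s s≤N = boundedUpTo s s≤N s 1≤s ℕP.≤-refl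

module _ (ρ : ℕ → ℚ) (n e : ℕ)
  (nonNeg : ∀ k → 1 ℕ.≤ k → k ℕ.≤ n → 0ℚ ≤ ρ k)
  (subadditive : ∀ k t → 1 ℕ.≤ k → 1 ℕ.≤ t → k ℕ.+ t ℕ.≤ n → ρ (k ℕ.+ t) ≤ ρ k + ρ t)
  (periodic : ∀ k → 1 ℕ.≤ k → k ℕ.+ suc e ℕ.≤ n → ρ (k ℕ.+ suc e) ≡ ρ k)
  (vanishes : ρ (suc e) ≡ 0ℚ)
  (d≤n : suc e ℕ.≤ n) where

  private
    d : ℕ
    d = suc e

    window : ℕ → ℚ
    window s = sumTo (λ j → ρ (s ℕ.+ j) * recip (s ℕ.+ j)) d

    shift-invariant : ∀ s → s ℕ.+ d ℕ.≤ n → sumTo (λ j → ρ (s ℕ.+ j)) d ≡ sumTo ρ d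
    shift-invariant zero    _       = refl
    shift-invariant (suc s) s+1+d≤n = trans shift (shift-invariant s (ℕP.≤-trans (ℕP.n≤1+n _) s+1+d≤n))
      where
      open ≡-Reasoning
      g : ℕ → ℚ
      g j = ρ (s ℕ.+ j)
      wraps : g (suc d) ≡ g 1
      wraps = begin
        ρ (s ℕ.+ suc d)   ≡⟨ cong ρ (ℕP.+-suc s d) ⟩
        ρ (suc s ℕ.+ d)   ≡⟨ periodic (suc s) (s≤s z≤n) s+1+d≤n ⟩
        ρ (suc s)         ≡⟨ cong ρ (ℕP.+-comm 1 s) ⟩
        ρ (s ℕ.+ 1)       ∎
      shift : sumTo (λ j → ρ (suc s ℕ.+ j)) d ≡ sumTo g d
      shift = +-cancelˡ (g 1) (sumTo (λ j → ρ (suc s ℕ.+ j)) d) (sumTo g d) (begin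
        g 1 + sumTo (λ j → ρ (suc s ℕ.+ j)) d  ≡⟨ cong (λ t → g 1 + t) (sumTo-cong d (λ j _ _ → cong ρ (sym (ℕP.+-suc s j)))) ⟩
        g 1 + sumTo (λ j → g (suc j)) d         ≡⟨ sumTo-unfoldˡ d ⟨
        sumTo g d + g (suc d)                   ≡⟨ cong (λ t → sumTo g d + t) wraps ⟩
        sumTo g d + g 1                         ≡⟨ ℚP.+-comm (sumTo g d) (g 1) ⟩
        g 1 + sumTo g d                         ∎)

    window-bound : ∀ s → s ℕ.≤ e → s ℕ.+ d ℕ.≤ n → recip (d ℕ.+ e) * sumTo ρ d ≤ window s
    window-bound s s≤e s+d≤n = begin
      recip (d ℕ.+ e) * sumTo ρ d                         ≡⟨ cong (recip (d ℕ.+ e) *_) (shift-invariant s s+d≤n) ⟨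
      recip (d ℕ.+ e) * sumTo (λ j → ρ (s ℕ.+ j)) d       ≡⟨ sumTo-*ˡ (recip (d ℕ.+ e)) d ⟨
      sumTo (λ j → recip (d ℕ.+ e) * ρ (s ℕ.+ j)) d       ≤⟨ sumTo-mono-≤ d termwise ⟩
      window s                                            ∎
      where
      open ℚP.≤-Reasoning
      termwise : ∀ j → 1 ℕ.≤ j → j ℕ.≤ d → recip (d ℕ.+ e) * ρ (s ℕ.+ j) ≤ ρ (s ℕ.+ j) * recip (s ℕ.+ j)
      termwise j 1≤j j≤d = subst (_≤ ρ (s ℕ.+ j) * recip (s ℕ.+ j)) (ℚP.*-comm (ρ (s ℕ.+ j)) (recip (d ℕ.+ e)))
        (ℚP.*-monoˡ-≤-nonNeg (ρ (s ℕ.+ j)) {{ℚ.nonNegative (nonNeg (s ℕ.+ j) 1≤s+j (ℕP.≤-trans (ℕP.+-monoʳ-≤ s j≤d) s+d≤n))}}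
          (recip-antitone 1≤s+j (subst (s ℕ.+ j ℕ.≤_) (ℕP.+-comm e d) (ℕP.+-mono-≤ s≤e j≤d))))
        where
        1≤s+j : 1 ℕ.≤ s ℕ.+ j
        1≤s+j = ℕP.≤-trans 1≤j (ℕP.m≤n+m j s)

    excess-bound : ∀ s → s ℕ.+ d ℕ.≤ n → window s ≤ ratioSum ρ (s ℕ.+ d) - ρ (s ℕ.+ d)
    excess-bound zero    _     = ℚP.≤-reflexive (sym (begin
      ratioSum ρ d - ρ d     ≡⟨ cong (ratioSum ρ d -_) vanishes ⟩
      ratioSum ρ d - 0ℚ      ≡⟨ minus-zero (ratioSum ρ d) ⟩
      ratioSum ρ d           ∎))
      where
      open ≡-Reasoning
      minus-zero : ∀ x → x - 0ℚ ≡ x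
      minus-zero = solve 1 (λ x → x :- con 0ℚ := x) refl
    excess-bound (suc s) s+d≤n = begin
      window (suc s)                                       ≡⟨ add-sub (ρ (suc s)) (window (suc s)) ⟩
      ρ (suc s) + window (suc s) - ρ (suc s)               ≤⟨ ℚP.+-monoˡ-≤ (ℚ.- ρ (suc s)) (ℚP.+-monoˡ-≤ (window (suc s)) ρ≤ratioSum) ⟩
      ratioSum ρ (suc s) + window (suc s) - ρ (suc s)      ≡⟨ cong₂ _-_ (sumTo-split (suc s) d) (periodic (suc s) (s≤s z≤n) s+d≤n) ⟨
      ratioSum ρ (suc s ℕ.+ d) - ρ (suc s ℕ.+ d)           ∎
      where
      open ℚP.≤-Reasoning
      add-sub : ∀ x w → w ≡ x + w - x
      add-sub = solve 2 (λ x w → w := x :+ w :- x) refl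
      ρ≤ratioSum : ρ (suc s) ≤ ratioSum ρ (suc s)
      ρ≤ratioSum = subadditive⇒≤ratioSum ρ n subadditive (suc s) (s≤s z≤n) (ℕP.≤-trans (ℕP.m≤m+n (suc s) d) s+d≤n)

    representative : Σ[ s ∈ ℕ ] s ℕ.≤ e × s ℕ.+ d ℕ.≤ n × ρ n ≡ ρ (s ℕ.+ d)
    representative = s , ℕP.≤-pred (ℕ.m%n<n (n ∸ d) d) , subst (s ℕ.+ d ℕ.≤_) (sym n≡) (ℕP.m≤m+n (s ℕ.+ d) (q ℕ.* d)) ,
                     trans (cong ρ n≡) (iterate q (s ℕ.+ d) (ℕP.≤-trans (s≤s z≤n) (ℕP.m≤n+m d s)) (ℕP.≤-reflexive (sym n≡)))
      where
      s q : ℕ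
      s = (n ∸ d) ℕ.% d
      q = (n ∸ d) ℕ./ d
      n≡ : n ≡ s ℕ.+ d ℕ.+ q ℕ.* d
      n≡ = begin
        n                        ≡⟨ ℕP.m+[n∸m]≡n d≤n ⟨
        d ℕ.+ (n ∸ d)            ≡⟨ cong (d ℕ.+_) (ℕ.m≡m%n+[m/n]*n (n ∸ d) d) ⟩
        d ℕ.+ (s ℕ.+ q ℕ.* d)    ≡⟨ reorder d s (q ℕ.* d) ⟩
        s ℕ.+ d ℕ.+ q ℕ.* d      ∎
        where
        open ≡-Reasoning
        reorder : ∀ d s m → d ℕ.+ (s ℕ.+ m) ≡ s ℕ.+ d ℕ.+ m
        reorder = ℕ-solve-∀
      iterate : ∀ q k → 1 ℕ.≤ k → k ℕ.+ q ℕ.* d ℕ.≤ n → ρ (k ℕ.+ q ℕ.* d) ≡ ρ k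
      iterate zero    k _   _        = cong ρ (ℕP.+-identityʳ k)
      iterate (suc q) k 1≤k k+qd≤n = begin
        ρ (k ℕ.+ (d ℕ.+ q ℕ.* d))   ≡⟨ cong ρ (reorder k d (q ℕ.* d)) ⟩
        ρ (k ℕ.+ q ℕ.* d ℕ.+ d)     ≡⟨ periodic (k ℕ.+ q ℕ.* d) (ℕP.≤-trans 1≤k (ℕP.m≤m+n k _)) (subst (ℕ._≤ n) (reorder k d (q ℕ.* d)) k+qd≤n) ⟩
        ρ (k ℕ.+ q ℕ.* d)           ≡⟨ iterate q k 1≤k (ℕP.≤-trans (ℕP.+-monoʳ-≤ k (ℕP.m≤n+m (q ℕ.* d) d)) k+qd≤n) ⟩
        ρ k                         ∎
        where
        open ≡-Reasoning
        reorder : ∀ k d m → k ℕ.+ (d ℕ.+ m) ≡ k ℕ.+ m ℕ.+ d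
        reorder = ℕ-solve-∀

  periodic-subadditive-bound : recip (suc e ℕ.+ e) * sumTo ρ (suc e) ≤ ratioSum ρ n - ρ n
  periodic-subadditive-bound with representative
  ... | s , s≤e , s+d≤n , ρn≡ρ[s+d] = begin
    recip (d ℕ.+ e) * sumTo ρ d                ≤⟨ window-bound s s≤e s+d≤n ⟩
    window s                                   ≤⟨ excess-bound s s+d≤n ⟩
    ratioSum ρ (s ℕ.+ d) - ρ (s ℕ.+ d)         ≤⟨ ℚP.+-monoˡ-≤ (ℚ.- ρ (s ℕ.+ d)) (sumTo-extend s+d≤n F≥0) ⟩
    ratioSum ρ n - ρ (s ℕ.+ d)                 ≡⟨ cong (λ x → ratioSum ρ n - x) ρn≡ρ[s+d] ⟨
    ratioSum ρ n - ρ n                         ∎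
    where
    open ℚP.≤-Reasoning
    F≥0 : ∀ k → s ℕ.+ d ℕ.< k → k ℕ.≤ n → 0ℚ ≤ ρ k * recip k
    F≥0 k s+d<k k≤n = ℚP.≤-trans (ℚP.≤-reflexive (sym (ℚP.*-zeroˡ (recip k))))
      (ℚP.*-monoʳ-≤-nonNeg (recip k) {{ℚ.nonNegative (recip-nonNeg k)}} (nonNeg k (ℕP.≤-trans (s≤s z≤n) s+d<k) k≤n))

sixth-bound : ∀ e → 1 ℕ.≤ e → ∀ S → S + S ≡ fromℤ (+ e) * fromℤ (+ suc e) →
              fromℤ (+ suc e) * recip 6 ≤ recip (suc e ℕ.+ e) * S
sixth-bound e 1≤e S S+S≡ed = ℚP.*-cancelˡ-≤-pos C {{ℚP.normalize-pos (suc e ℕ.+ e) 1}} (begin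
  C * (D * recip 6)                  ≡⟨ ℚP.*-assoc C D (recip 6) ⟨
  C * D * recip 6                    ≤⟨ ℚP.*-monoʳ-≤-nonNeg (recip 6) CD≤3eD ⟩
  fromℤ (+ 3) * (E * D) * recip 6    ≡⟨ cong (λ t → fromℤ (+ 3) * t * recip 6) S+S≡ed ⟨
  fromℤ (+ 3) * (S + S) * recip 6    ≡⟨ half S ⟩
  S                                  ≡⟨ ℚP.*-identityˡ S ⟨
  1ℚ * S                             ≡⟨ cong (_* S) (recip-inverse (e ℕ.+ e)) ⟨
  C * recip (suc e ℕ.+ e) * S        ≡⟨ ℚP.*-assoc C (recip (suc e ℕ.+ e)) S ⟩
  C * (recip (suc e ℕ.+ e) * S)      ∎)
  where
  open ℚP.≤-Reasoning
  C D E : ℚ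
  C = fromℤ (+ (suc e ℕ.+ e))
  D = fromℤ (+ suc e)
  E = fromℤ (+ e)
  half : ∀ S → fromℤ (+ 3) * (S + S) * recip 6 ≡ S
  half = solve 1 (λ S → con (fromℤ (+ 3)) :* (S :+ S) :* con (recip 6) := S) refl
  triple : ∀ e → e ℕ.+ (e ℕ.+ e) ≡ 3 ℕ.* e
  triple = ℕ-solve-∀
  c≤3e : suc e ℕ.+ e ℕ.≤ 3 ℕ.* e
  c≤3e = subst (suc e ℕ.+ e ℕ.≤_) (triple e) (ℕP.+-monoˡ-≤ (e ℕ.+ e) 1≤e)
  CD≤3eD : C * D ≤ fromℤ (+ 3) * (E * D)
  CD≤3eD = subst₂ _≤_ (fromℤ-pos-* (suc e ℕ.+ e) (suc e))
                      (trans (fromℤ-pos-* 3 (e ℕ.* suc e)) (cong (fromℤ (+ 3) *_) (fromℤ-pos-* e (suc e))))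
                      (fromℤ-mono-≤ (ℤ.+≤+ (subst ((suc e ℕ.+ e) ℕ.* suc e ℕ.≤_) (ℕP.*-assoc 3 e (suc e)) (ℕP.*-monoˡ-≤ (suc e) c≤3e))))

+-cancelˡ-< : ∀ i {j k} → i ℤ.+ j ℤ.< i ℤ.+ k → j ℤ.< k
+-cancelˡ-< i {j} {k} i+j<i+k = subst₂ ℤ._<_ (cancel i j) (cancel i k) (ℤP.+-monoʳ-< (ℤ.- i) i+j<i+k)
  where
  cancel : ∀ i j → ℤ.- i ℤ.+ (i ℤ.+ j) ≡ j
  cancel = ℤ-solve-∀

module Multiples (d : ℕ) where

  private
    D : ℤ
    D = + d

  multiple-nonNeg : ∀ {u v} z → + 0 ℤ.≤ u → v ℤ.< D → u ≡ v ℤ.+ z ℤ.* D → + 0 ℤ.≤ z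
  multiple-nonNeg {u} {v} z 0≤u v<D u≡v+zD =
    ℤP.i<j⇒suc[i]≤j (ℤP.*-cancelʳ-<-nonNeg {ℤ.-1ℤ} {z} D (+-cancelˡ-< v {ℤ.-1ℤ ℤ.* D} {z ℤ.* D} (begin-strict
    v ℤ.+ ℤ.-1ℤ ℤ.* D  ≡⟨ cong (λ t → v ℤ.+ t) (ℤP.-1*i≡-i D) ⟩
    v ℤ.- D            <⟨ subst (v ℤ.- D ℤ.<_) (ℤP.+-inverseʳ D) (ℤP.+-monoˡ-< (ℤ.- D) v<D) ⟩
    + 0                ≤⟨ 0≤u ⟩
    u                  ≡⟨ u≡v+zD ⟩
    v ℤ.+ z ℤ.* D      ∎)))
    where open ℤP.≤-Reasoning

  multiple-nonPos : ∀ {u v} z → + 0 ℤ.≤ v → u ℤ.< D → u ≡ v ℤ.+ z ℤ.* D → z ℤ.≤ + 0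
  multiple-nonPos {u} {v} z 0≤v u<D u≡v+zD =
    ℤP.i<j⇒i≤pred[j] (ℤP.*-cancelʳ-<-nonNeg {z} {+ 1} D (+-cancelˡ-< v {z ℤ.* D} {+ 1 ℤ.* D} (begin-strict
    v ℤ.+ z ℤ.* D      ≡⟨ u≡v+zD ⟨
    u                  <⟨ u<D ⟩
    D                  ≤⟨ ℤP.+-monoˡ-≤ D 0≤v ⟩
    v ℤ.+ D            ≡⟨ cong (λ t → v ℤ.+ t) (ℤP.*-identityˡ D) ⟨
    v ℤ.+ + 1 ℤ.* D    ∎)))
    where open ℤP.≤-Reasoning

  residue-unique : ∀ {u v} z → + 0 ℤ.≤ u → u ℤ.< D → + 0 ℤ.≤ v → v ℤ.< D → u ≡ v ℤ.+ z ℤ.* D → u ≡ v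
  residue-unique {u} {v} z 0≤u u<D 0≤v v<D u≡v+zD = begin
    u                ≡⟨ u≡v+zD ⟩
    v ℤ.+ z ℤ.* D    ≡⟨ cong (λ t → v ℤ.+ t ℤ.* D) z≡0 ⟩
    v ℤ.+ + 0 ℤ.* D  ≡⟨ ℤP.+-identityʳ v ⟩
    v                ∎
    where
    open ≡-Reasoning
    z≡0 : z ≡ + 0
    z≡0 = ℤP.≤-antisym (multiple-nonPos z 0≤v u<D u≡v+zD) (multiple-nonNeg z 0≤u v<D u≡v+zD)

-- The hypothesis says a k = ⌊k p / d⌋, so r k is the residue of k p modulo d.
module Residues (n d : ℕ) (p : ℤ) (a : ℕ → ℤ)
  (quotient : ∀ k → 1 ℕ.≤ k → k ℕ.≤ n → a k ℤ.* + d ℤ.≤ p ℤ.* + k × p ℤ.* + k ℤ.< (a k ℤ.+ + 1) ℤ.* + d) where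

  open Multiples d

  private
    D : ℤ
    D = + d

  r : ℕ → ℤ
  r k = p ℤ.* + k ℤ.- a k ℤ.* D

  r-nonNeg : ∀ k → 1 ℕ.≤ k → k ℕ.≤ n → + 0 ℤ.≤ r k
  r-nonNeg k 1≤k k≤n = ℤP.i≤j⇒0≤j-i (proj₁ (quotient k 1≤k k≤n))

  r<D : ∀ k → 1 ℕ.≤ k → k ℕ.≤ n → r k ℤ.< D
  r<D k 1≤k k≤n = begin-strict
    p ℤ.* + k ℤ.- a k ℤ.* D            <⟨ ℤP.+-monoˡ-< (ℤ.- (a k ℤ.* D)) (proj₂ (quotient k 1≤k k≤n)) ⟩
    (a k ℤ.+ + 1) ℤ.* D ℤ.- a k ℤ.* D  ≡⟨ cancel (a k) D ⟩
    D                                  ∎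
    where
    open ℤP.≤-Reasoning
    cancel : ∀ x D → (x ℤ.+ + 1) ℤ.* D ℤ.- x ℤ.* D ≡ D
    cancel = ℤ-solve-∀

  r-subadditive : ∀ k t → 1 ℕ.≤ k → 1 ℕ.≤ t → k ℕ.+ t ℕ.≤ n → r (k ℕ.+ t) ℤ.≤ r k ℤ.+ r t
  r-subadditive k t 1≤k 1≤t k+t≤n = begin
    r (k ℕ.+ t)                ≡⟨ ℤP.+-identityʳ (r (k ℕ.+ t)) ⟨
    r (k ℕ.+ t) ℤ.+ + 0        ≤⟨ ℤP.+-monoʳ-≤ (r (k ℕ.+ t)) (ℤP.*-monoʳ-≤-nonNeg D 0≤z) ⟩
    r (k ℕ.+ t) ℤ.+ z ℤ.* D    ≡⟨ sum≡ ⟨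
    r k ℤ.+ r t                ∎
    where
    open ℤP.≤-Reasoning
    z : ℤ
    z = a (k ℕ.+ t) ℤ.- a k ℤ.- a t
    identity : ∀ p k t D x y z → p ℤ.* k ℤ.- x ℤ.* D ℤ.+ (p ℤ.* t ℤ.- y ℤ.* D)
                                  ≡ p ℤ.* (k ℤ.+ t) ℤ.- z ℤ.* D ℤ.+ (z ℤ.- x ℤ.- y) ℤ.* D
    identity = ℤ-solve-∀
    sum≡ : r k ℤ.+ r t ≡ r (k ℕ.+ t) ℤ.+ z ℤ.* D
    sum≡ = trans (identity p (+ k) (+ t) D (a k) (a t) (a (k ℕ.+ t)))
                 (cong (λ s → p ℤ.* s ℤ.- a (k ℕ.+ t) ℤ.* D ℤ.+ z ℤ.* D) (sym (ℤP.pos-+ k t)))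
    k≤n : k ℕ.≤ n
    k≤n = ℕP.≤-trans (ℕP.m≤m+n k t) k+t≤n
    t≤n : t ℕ.≤ n
    t≤n = ℕP.≤-trans (ℕP.m≤n+m t k) k+t≤n
    0≤z : + 0 ℤ.≤ z
    0≤z = multiple-nonNeg z (ℤP.+-mono-≤ (r-nonNeg k 1≤k k≤n) (r-nonNeg t 1≤t t≤n))
            (r<D (k ℕ.+ t) (ℕP.≤-trans 1≤k (ℕP.m≤m+n k t)) k+t≤n) sum≡

  r-periodic : ∀ k → 1 ℕ.≤ k → k ℕ.+ d ℕ.≤ n → r (k ℕ.+ d) ≡ r k
  r-periodic k 1≤k k+d≤n = residue-unique (p ℤ.+ a k ℤ.- a (k ℕ.+ d))
    (r-nonNeg (k ℕ.+ d) (ℕP.≤-trans 1≤k (ℕP.m≤m+n k d)) k+d≤n) (r<D (k ℕ.+ d) (ℕP.≤-trans 1≤k (ℕP.m≤m+n k d)) k+d≤n)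
    (r-nonNeg k 1≤k k≤n) (r<D k 1≤k k≤n)
    (trans (cong (λ s → p ℤ.* s ℤ.- a (k ℕ.+ d) ℤ.* D) (ℤP.pos-+ k d)) (identity p (+ k) D (a k) (a (k ℕ.+ d))))
    where
    k≤n : k ℕ.≤ n
    k≤n = ℕP.≤-trans (ℕP.m≤m+n k d) k+d≤n
    identity : ∀ p k D x y → p ℤ.* (k ℤ.+ D) ℤ.- y ℤ.* D ≡ p ℤ.* k ℤ.- x ℤ.* D ℤ.+ (p ℤ.+ x ℤ.- y) ℤ.* D
    identity = ℤ-solve-∀

  r-complement : ∀ k t → 1 ℕ.≤ k → 1 ℕ.≤ t → k ℕ.+ t ≡ d → d ℕ.≤ n → r k ≢ + 0 → r k ℤ.+ r t ≡ D
  r-complement k t 1≤k 1≤t k+t≡d d≤n rk≢0 = begin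
    r k ℤ.+ r t            ≡⟨ cong (λ s → r k ℤ.+ s) rt≡D-rk ⟩
    r k ℤ.+ (D ℤ.- r k)    ≡⟨ cancel (r k) D ⟩
    D                      ∎
    where
    open ≡-Reasoning
    cancel : ∀ x D → x ℤ.+ (D ℤ.- x) ≡ D
    cancel = ℤ-solve-∀
    k≤n : k ℕ.≤ n
    k≤n = ℕP.≤-trans (ℕP.m≤m+n k t) (subst (ℕ._≤ n) (sym k+t≡d) d≤n)
    t≤n : t ℕ.≤ n
    t≤n = ℕP.≤-trans (ℕP.m≤n+m t k) (subst (ℕ._≤ n) (sym k+t≡d) d≤n)
    0<rk : + 0 ℤ.< r k
    0<rk = ℤP.≤∧≢⇒< (r-nonNeg k 1≤k k≤n) (λ 0≡rk → rk≢0 (sym 0≡rk))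
    z : ℤ
    z = p ℤ.- a k ℤ.- a t ℤ.- + 1
    identity : ∀ p k t x y → p ℤ.* t ℤ.- y ℤ.* (k ℤ.+ t)
                               ≡ (k ℤ.+ t) ℤ.- (p ℤ.* k ℤ.- x ℤ.* (k ℤ.+ t)) ℤ.+ (p ℤ.- x ℤ.- y ℤ.- + 1) ℤ.* (k ℤ.+ t)
    identity = ℤ-solve-∀
    congruent : r t ≡ D ℤ.- r k ℤ.+ z ℤ.* D
    congruent = subst (λ D′ → p ℤ.* + t ℤ.- a t ℤ.* D′ ≡ D′ ℤ.- (p ℤ.* + k ℤ.- a k ℤ.* D′) ℤ.+ z ℤ.* D′)
                      (cong +_ k+t≡d) (identity p (+ k) (+ t) (a k) (a t))
    rt≡D-rk : r t ≡ D ℤ.- r k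
    rt≡D-rk = residue-unique z (r-nonNeg t 1≤t t≤n) (r<D t 1≤t t≤n)
      (ℤP.i≤j⇒0≤j-i (ℤP.<⇒≤ (r<D k 1≤k k≤n)))
      (subst (D ℤ.- r k ℤ.<_) (ℤP.+-identityʳ D) (ℤP.+-monoʳ-< D (ℤP.neg-mono-< 0<rk)))
      congruent

  r-spec : ∀ k → fromℤ (r k) + fromℤ (a k) * fromℤ D ≡ fromℤ p * fromℤ (+ k)
  r-spec k = begin
    fromℤ (r k) + fromℤ (a k) * fromℤ D   ≡⟨ cong (λ t → fromℤ (r k) + t) (fromℤ-* (a k) D) ⟨
    fromℤ (r k) + fromℤ (a k ℤ.* D)       ≡⟨ fromℤ-+ (r k) (a k ℤ.* D) ⟨
    fromℤ (r k ℤ.+ a k ℤ.* D)             ≡⟨ cong fromℤ (cancel p (+ k) (a k ℤ.* D)) ⟩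
    fromℤ (p ℤ.* + k)                     ≡⟨ fromℤ-* p (+ k) ⟩
    fromℤ p * fromℤ (+ k)                 ∎
    where
    open ≡-Reasoning
    cancel : ∀ p k y → p ℤ.* k ℤ.- y ℤ.+ y ≡ p ℤ.* k
    cancel = ℤ-solve-∀

  scaled-frac : ∀ j → fromℤ D * frac a (suc j) ≡ fromℤ p - fromℤ (r (suc j)) * recip (suc j)
  scaled-frac j = begin
    fromℤ D * frac a k                                   ≡⟨ cong (fromℤ D *_) (frac≡*recip a k) ⟩
    fromℤ D * (A * I)                                    ≡⟨ expand (fromℤ D) A I R ⟩
    (R + A * fromℤ D) * I - R * I                        ≡⟨ cong (λ t → t * I - R * I) (r-spec k) ⟩
    fromℤ p * fromℤ (+ k) * I - R * I                    ≡⟨ cong (λ t → t - R * I) (ℚP.*-assoc (fromℤ p) (fromℤ (+ k)) I) ⟩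
    fromℤ p * (fromℤ (+ k) * I) - R * I                  ≡⟨ cong (λ t → fromℤ p * t - R * I) (recip-inverse j) ⟩
    fromℤ p * 1ℚ - R * I                                 ≡⟨ cong (_- R * I) (ℚP.*-identityʳ (fromℤ p)) ⟩
    fromℤ p - R * I                                      ∎
    where
    open ≡-Reasoning
    k : ℕ
    k = suc j
    A I R : ℚ
    A = fromℤ (a k)
    I = recip k
    R = fromℤ (r k)
    expand : ∀ D A I R → D * (A * I) ≡ (R + A * D) * I - R * I
    expand = solve 4 (λ D A I R → D :* (A :* I) := (R :+ A :* D) :* I :- R :* I) refl

  scaled-sumFrac : ∀ m → fromℤ D * sumFrac a m ≡ fromℤ (+ m) * fromℤ p - ratioSum (λ k → fromℤ (r k)) m
  scaled-sumFrac zero    = zeros (fromℤ D) (fromℤ p)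
    where
    zeros : ∀ D P → D * 0ℚ ≡ 0ℚ * P - 0ℚ
    zeros = solve 2 (λ D P → D :* con 0ℚ := con 0ℚ :* P :- con 0ℚ) refl
  scaled-sumFrac (suc m) = begin
    fromℤ D * (sumFrac a m + frac a (suc m))                    ≡⟨ ℚP.*-distribˡ-+ (fromℤ D) (sumFrac a m) (frac a (suc m)) ⟩
    fromℤ D * sumFrac a m + fromℤ D * frac a (suc m)            ≡⟨ cong₂ _+_ (scaled-sumFrac m) (scaled-frac m) ⟩
    fromℤ (+ m) * P - S + (P - F)                               ≡⟨ regroup (fromℤ (+ m)) P S F ⟩
    (fromℤ (+ m) + 1ℚ) * P - (S + F)                            ≡⟨ cong (λ t → t * P - (S + F)) (fromℤ-suc m) ⟨
    fromℤ (+ suc m) * P - (S + F)                               ∎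
    where
    open ≡-Reasoning
    P S F : ℚ
    P = fromℤ p
    S = ratioSum (λ k → fromℤ (r k)) m
    F = fromℤ (r (suc m)) * recip (suc m)
    regroup : ∀ M P S F → M * P - S + (P - F) ≡ (M + 1ℚ) * P - (S + F)
    regroup = solve 4 (λ M P S F → M :* P :- S :+ (P :- F) := (M :+ con 1ℚ) :* P :- (S :+ F)) refl

  scaled-gap : ∀ m → fromℤ D * (fromℤ (a m) - sumFrac a m) ≡ ratioSum (λ k → fromℤ (r k)) m - fromℤ (r m)
  scaled-gap m = begin
    fromℤ D * (A - sumFrac a m)                      ≡⟨ expand (fromℤ D) A R (sumFrac a m) ⟩
    (R + A * fromℤ D) - R - fromℤ D * sumFrac a m    ≡⟨ cong (λ t → t - R - fromℤ D * sumFrac a m) (r-spec m) ⟩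
    P * M - R - fromℤ D * sumFrac a m                ≡⟨ cong (λ t → P * M - R - t) (scaled-sumFrac m) ⟩
    P * M - R - (M * P - S)                          ≡⟨ cancel P M R S ⟩
    S - R                                            ∎
    where
    open ≡-Reasoning
    A M P R S : ℚ
    A = fromℤ (a m)
    M = fromℤ (+ m)
    P = fromℤ p
    R = fromℤ (r m)
    S = ratioSum (λ k → fromℤ (r k)) m
    expand : ∀ D A R T → D * (A - T) ≡ (R + A * D) - R - D * T
    expand = solve 4 (λ D A R T → D :* (A :- T) := (R :+ A :* D) :- R :- D :* T) refl
    cancel : ∀ P M R S → P * M - R - (M * P - S) ≡ S - R
    cancel = solve 4 (λ P M R S → P :* M :- R :- (M :* P :- S) := S :- R) refl

cut-< : (x : ℝ) {q q′ : ℚ} → ¬ U x q → U x q′ → q < q′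
cut-< x {q} {q′} ¬Uq Uq′ with ℚP.<-cmp q q′
... | tri< q<q′ _ _ = q<q′
... | tri≈ _ refl _ = ⊥-elim (¬Uq Uq′)
... | tri> _ _ q′<q = ⊥-elim (¬Uq (roundedU' x q′ q q′<q Uq′))

xmax-upper : ∀ a m k → 1 ℕ.≤ k → k ℕ.≤ m → frac a k ≤ xmax a m
xmax-upper a zero    (suc k) _   ()
xmax-upper a (suc m) k       1≤k k≤m+1 with ℕP.m≤n⇒m<n∨m≡n k≤m+1
... | inj₁ k≤m  = ℚP.p≤q⇒p≤q⊔r (frac a (suc m)) (xmax-upper a m k 1≤k (ℕP.≤-pred k≤m))
... | inj₂ refl = ℚP.p≤q⊔p (xmax a m) (frac a (suc m))

module Argmax (n : ℕ) (x : ℝ) (a : ℕ → ℤ)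
  (floor : ∀ k → 1 ℕ.≤ k → k ℕ.≤ n → IsFloorMul x k (a k))
  (e : ℕ) (smallest : IsSmallestArgmax a n (suc e)) where

  d : ℕ
  d = suc e

  d≤n : d ℕ.≤ n
  d≤n = proj₁ (proj₂ smallest)

  frac-d≡xmax : frac a d ≡ xmax a n
  frac-d≡xmax = proj₁ (proj₂ (proj₂ smallest))

  minimal : ∀ k → 1 ℕ.≤ k → k ℕ.< d → frac a k ≢ xmax a n
  minimal = proj₂ (proj₂ (proj₂ smallest))

  -- a k / k ≤ a d / d ≤ x < (a k + 1) / k
  quotient : ∀ k → 1 ℕ.≤ k → k ℕ.≤ n → a k ℤ.* + d ℤ.≤ a d ℤ.* + k × a d ℤ.* + k ℤ.< (a k ℤ.+ + 1) ℤ.* + d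
  quotient (suc i) _ k≤n =
    /≤/⇒*≤* (a (suc i)) (a d) i e (subst (frac a (suc i) ≤_) (sym frac-d≡xmax) (xmax-upper a n (suc i) (s≤s z≤n) k≤n)) ,
    /</⇒*<* (a d) (a (suc i) ℤ.+ + 1) e i (cut-< x (proj₁ (floor d (s≤s z≤n) d≤n)) (proj₂ (floor (suc i) (s≤s z≤n) k≤n)))

  open Residues n d (a d) a quotient public

  ρ : ℕ → ℚ
  ρ k = fromℤ (r k)

  r-below-d : ∀ k → 1 ℕ.≤ k → k ℕ.< d → r k ≢ + 0
  r-below-d (suc i) 1≤k k<d rk≡0 =
    minimal (suc i) 1≤k k<d (trans (*≡*⇒/≡/ (a (suc i)) (a d) i e (sym (ℤP.i-j≡0⇒i≡j _ _ rk≡0))) frac-d≡xmax)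

  ρ-nonNeg : ∀ k → 1 ℕ.≤ k → k ℕ.≤ n → 0ℚ ≤ ρ k
  ρ-nonNeg k 1≤k k≤n = fromℤ-mono-≤ (r-nonNeg k 1≤k k≤n)

  ρ-subadditive : ∀ k t → 1 ℕ.≤ k → 1 ℕ.≤ t → k ℕ.+ t ℕ.≤ n → ρ (k ℕ.+ t) ≤ ρ k + ρ t
  ρ-subadditive k t 1≤k 1≤t k+t≤n = subst (ρ (k ℕ.+ t) ≤_) (fromℤ-+ (r k) (r t)) (fromℤ-mono-≤ (r-subadditive k t 1≤k 1≤t k+t≤n))

  ρ-periodic : ∀ k → 1 ℕ.≤ k → k ℕ.+ d ℕ.≤ n → ρ (k ℕ.+ d) ≡ ρ k
  ρ-periodic k 1≤k k+d≤n = cong fromℤ (r-periodic k 1≤k k+d≤n)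

  ρ-d≡0 : ρ d ≡ 0ℚ
  ρ-d≡0 = cong fromℤ (ℤP.+-inverseʳ (a d ℤ.* + d))

  ρ-complement : ∀ k → 1 ℕ.≤ k → k ℕ.≤ e → ρ k + ρ (suc e ∸ k) ≡ fromℤ (+ d)
  ρ-complement k 1≤k k≤e = trans (sym (fromℤ-+ (r k) (r (d ∸ k))))
    (cong fromℤ (r-complement k (d ∸ k) 1≤k (ℕP.m<n⇒0<n∸m (s≤s k≤e)) (ℕP.m+[n∸m]≡n (ℕP.m≤n⇒m≤1+n k≤e)) d≤n (r-below-d k 1≤k (s≤s k≤e))))

gap-vanishes : ∀ n (x : ℝ) a → (∀ k → 1 ℕ.≤ k → k ℕ.≤ n → IsFloorMul x k (a k)) →
               1 ℕ.≤ n → IsSmallestArgmax a n 1 → a n / 1 ≡ sumFrac a n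
gap-vanishes n x a floor 1≤n smallest = begin
  fromℤ (a n)                                              ≡⟨ restore (fromℤ (a n)) (sumFrac a n) ⟩
  fromℤ (+ 1) * (fromℤ (a n) - sumFrac a n) + sumFrac a n  ≡⟨ cong (_+ sumFrac a n) (scaled-gap n) ⟩
  ratioSum ρ n - ρ n + sumFrac a n                         ≡⟨ cong₂ (λ s t → s - t + sumFrac a n) ratioSum≡0 (ρ≡0 n 1≤n ℕP.≤-refl) ⟩
  0ℚ - 0ℚ + sumFrac a n                                    ≡⟨ ℚP.+-identityˡ (sumFrac a n) ⟩
  sumFrac a n                                              ∎
  where
  open Argmax n x a floor 0 smallest
  open ≡-Reasoning
  restore : ∀ A S → A ≡ fromℤ (+ 1) * (A - S) + S
  restore = solve 2 (λ A S → A := con (fromℤ (+ 1)) :* (A :- S) :+ S) refl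
  ρ≡0 : ∀ k → 1 ℕ.≤ k → k ℕ.≤ n → ρ k ≡ 0ℚ
  ρ≡0 k 1≤k k≤n = cong fromℤ (ℤP.≤-antisym (ℤP.i<j⇒i≤pred[j] (r<D k 1≤k k≤n)) (r-nonNeg k 1≤k k≤n))
  ratioSum≡0 : ratioSum ρ n ≡ 0ℚ
  ratioSum≡0 = begin
    ratioSum ρ n                  ≡⟨ sumTo-cong n (λ k 1≤k k≤n → trans (cong (_* recip k) (ρ≡0 k 1≤k k≤n)) (ℚP.*-zeroˡ (recip k))) ⟩
    sumTo (λ _ → 0ℚ) n            ≡⟨ sumTo-const 0ℚ n ⟩
    fromℤ (+ n) * 0ℚ              ≡⟨ ℚP.*-zeroʳ (fromℤ (+ n)) ⟩
    0ℚ                            ∎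

gap-sixth : ∀ n (x : ℝ) a → (∀ k → 1 ℕ.≤ k → k ℕ.≤ n → IsFloorMul x k (a k)) →
            ∀ e → IsSmallestArgmax a n (suc (suc e)) → + 1 / 6 + sumFrac a n ≤ a n / 1
gap-sixth n x a floor e smallest = begin
  recip 6 + sumFrac a n                        ≤⟨ ℚP.+-monoˡ-≤ (sumFrac a n) sixth≤gap ⟩
  fromℤ (a n) - sumFrac a n + sumFrac a n      ≡⟨ sub-add (fromℤ (a n)) (sumFrac a n) ⟩
  fromℤ (a n)                                  ∎
  where
  open Argmax n x a floor (suc e) smallest
  open ℚP.≤-Reasoning
  sub-add : ∀ A S → A - S + S ≡ A
  sub-add = solve 2 (λ A S → A :- S :+ S := A) refl
  sumTo-ρ-d : sumTo ρ d ≡ sumTo ρ (suc e)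
  sumTo-ρ-d = trans (cong (λ t → sumTo ρ (suc e) + t) ρ-d≡0) (ℚP.+-identityʳ (sumTo ρ (suc e)))
  twice-sumTo-ρ : sumTo ρ d + sumTo ρ d ≡ fromℤ (+ suc e) * fromℤ (+ d)
  twice-sumTo-ρ = begin-equality
    sumTo ρ d + sumTo ρ d                    ≡⟨ cong (λ s → s + s) sumTo-ρ-d ⟩
    sumTo ρ (suc e) + sumTo ρ (suc e)        ≡⟨ sumTo-pairs ρ (fromℤ (+ d)) (suc e) ρ-complement ⟩
    fromℤ (+ suc e) * fromℤ (+ d)            ∎
  sixth≤gap : recip 6 ≤ fromℤ (a n) - sumFrac a n
  sixth≤gap = ℚP.*-cancelˡ-≤-pos (fromℤ (+ d)) {{ℚP.normalize-pos d 1}} (begin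
    fromℤ (+ d) * recip 6                            ≤⟨ sixth-bound (suc e) (s≤s z≤n) (sumTo ρ d) twice-sumTo-ρ ⟩
    recip (d ℕ.+ suc e) * sumTo ρ d                  ≤⟨ periodic-subadditive-bound ρ n (suc e) ρ-nonNeg ρ-subadditive ρ-periodic ρ-d≡0 d≤n ⟩
    ratioSum ρ n - ρ n                               ≡⟨ scaled-gap n ⟨
    fromℤ (+ d) * (fromℤ (a n) - sumFrac a n)        ∎)

proposition3p1 : (n : ℕ) → 1 ℕ.≤ n → (x : ℝ) → (a : ℕ → ℤ) →
    (∀ k → 1 ℕ.≤ k → k ℕ.≤ n → IsFloorMul x k (a k)) →
    (d : ℕ) → IsSmallestArgmax a n d →
    (d ≡ 1 → a n / 1 ≡ sumFrac a n) ×
    (d ≢ 1 → (+ 1 / 6) + sumFrac a n ≤ a n / 1)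
proposition3p1 n 1≤n x a floor zero          (() , _)
proposition3p1 n 1≤n x a floor (suc zero)    smallest = (λ _ → gap-vanishes n x a floor 1≤n smallest) , (λ d≢1 → ⊥-elim (d≢1 refl))
proposition3p1 n 1≤n x a floor (suc (suc e)) smallest = (λ ()) , (λ _ → gap-sixth n x a floor e smallest)
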